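{- Let $C_3$ be the triangle whose edges have positive integer weights $a,b,c$ satisfying the triangle inequality ($a\le b+c$, $b\le a+c$, $c\le a+b$). Then $c(C_3,\mathbf{w})=\left\lceil \frac{a+b+c}{2}\right\rceil$.
   Context: For a weighted graph, $d_\mathbf{w}(u,v)$ is the minimum total weight of a $(u,v)$-path. A binary addressing of length $m$ is a map $f:V\to\{0,1\}^m$ with $d_\mathbf{w}(u,v)\le d_H(f(u),f(v))$ for all vertices $u,v$ ($d_H$ the Hamming distance); $c(G,\mathbf{w})$ is the minimum length of a binary addressing. -}

module Defs where

open import Data.Nat using (ℕ; zero; suc; _+_; _≤_; _<_)
open import Data.Bool using (Bool; true; false)
open import Data.Fin using (Fin; zero; suc)
open import Data.Vec using (Vec; []; _∷_)
open import Data.Product using (Σ; _×_; _,_)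
open import Relation.Nullary using (¬_)
open import Relation.Binary.PropositionalEquality using (_≡_)

-- A (finite, undirected) weighted graph on vertex set Fin n:
-- an adjacency relation and a weight for each (ordered pair of) vertices,
-- only used on adjacent pairs.
record WGraph : Set₁ where
  field
    n   : ℕ
    Adj : Fin n → Fin n → Set
    w   : Fin n → Fin n → ℕ
open WGraph public

data Walk (G : WGraph) : Fin (n G) → Fin (n G) → Set where
  [] : ∀ {u} → Walk G u u
  step : ∀ {u x v} → Adj G u x → Walk G x v → Walk G u v

weight : ∀ {G u v} → Walk G u v → ℕ
weight [] = 0
weight {G} {u} (step {x = x} _ p) = w G u x + weight p

-- "d_w(u,v) ≤ k": some (u,v)-walk has total weight at most k.
-- (d_w is the minimum weight of a (u,v)-walk; with nonnegative weights the
-- minimum over walks equals the minimum over paths.)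
DistLe : (G : WGraph) → Fin (n G) → Fin (n G) → ℕ → Set
DistLe G u v k = Σ (Walk G u v) (λ p → weight p ≤ k)

hamming : ∀ {m} → Vec Bool m → Vec Bool m → ℕ
hamming [] [] = 0
hamming (true ∷ xs) (true ∷ ys) = hamming xs ys
hamming (false ∷ xs) (false ∷ ys) = hamming xs ys
hamming (true ∷ xs) (false ∷ ys) = suc (hamming xs ys)
hamming (false ∷ xs) (true ∷ ys) = suc (hamming xs ys)

IsAddressing : (G : WGraph) (m : ℕ) → (Fin (n G) → Vec Bool m) → Set
IsAddressing G m f = ∀ u v → DistLe G u v (hamming (f u) (f v))

HasAddressing : WGraph → ℕ → Set
HasAddressing G m = Σ (Fin (n G) → Vec Bool m) (IsAddressing G m)

AddressingNumberIs : WGraph → ℕ → Set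
AddressingNumberIs G k = HasAddressing G k × (∀ m → m < k → ¬ HasAddressing G m)

triAdj : Fin 3 → Fin 3 → Set
triAdj i j = ¬ (i ≡ j)

triW : ℕ → ℕ → ℕ → Fin 3 → Fin 3 → ℕ
triW a b c zero (suc zero) = a
triW a b c (suc zero) zero = a
triW a b c (suc zero) (suc (suc zero)) = b
triW a b c (suc (suc zero)) (suc zero) = b
triW a b c zero (suc (suc zero)) = c
triW a b c (suc (suc zero)) zero = c
triW a b c _ _ = 0

C₃ : ℕ → ℕ → ℕ → WGraph
C₃ a b c = record { n = 3 ; Adj = triAdj ; w = triW a b c }

-- Lower bound: the weights of C₃ satisfy the triangle inequality, so no walk between two
-- vertices is lighter than the edge joining them, and the Hamming distance of their addresses
-- is at least that edge weight. Each coordinate contributes to at most two of the three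
-- pairwise Hamming distances of three words of length m, so a + b + c ≤ 2m.
-- Upper bound: for k = ⌈(a + b + c)/2⌉, split k coordinates into blocks of sizes k − b,
-- a + b − k and k − a, one per vertex, and address each vertex by the indicator word of its
-- own block; two addresses then differ exactly on the blocks of their two vertices.
module Submission where

open import Defs
open import Data.Nat using (ℕ; zero; suc; _+_; _≤_; z≤n; ⌈_/2⌉)
open import Data.Nat.Properties
open import Data.Nat.Tactic.RingSolver using (solve-∀)
open import Data.Bool using (Bool; true; false; _xor_; if_then_else_)
open import Data.Fin using (Fin)
open import Data.Fin.Patterns using (0F; 1F; 2F)
import Data.Fin.Properties as Fin
open import Data.Vec using (Vec; []; _∷_; [_]; _++_; replicate)
open import Data.Product using (_×_; _,_; ∃-syntax)
open import Relation.Nullary using (¬_; yes; no)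
open import Relation.Binary.PropositionalEquality using (_≡_; refl; sym; trans; cong; cong₂; subst)

n≤m+m⇒⌈n/2⌉≤m : ∀ {n m} → n ≤ m + m → ⌈ n /2⌉ ≤ m
n≤m+m⇒⌈n/2⌉≤m {n} {m} n≤m+m = subst (⌈ n /2⌉ ≤_) (sym (n≡⌈n+n/2⌉ m)) (⌈n/2⌉-mono n≤m+m)

m+m≤n⇒m≤⌈n/2⌉ : ∀ {m n} → m + m ≤ n → m ≤ ⌈ n /2⌉
m+m≤n⇒m≤⌈n/2⌉ {m} {n} m+m≤n = subst (_≤ ⌈ n /2⌉) (sym (n≡⌈n+n/2⌉ m)) (⌈n/2⌉-mono m+m≤n)

n≤⌈n/2⌉+⌈n/2⌉ : ∀ n → n ≤ ⌈ n /2⌉ + ⌈ n /2⌉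
n≤⌈n/2⌉+⌈n/2⌉ n = subst (_≤ ⌈ n /2⌉ + ⌈ n /2⌉) (⌊n/2⌋+⌈n/2⌉≡n n) (+-monoˡ-≤ ⌈ n /2⌉ (⌊n/2⌋≤⌈n/2⌉ n))

-- The witnesses are p = k − b, q = k − a and r = a + b − k.
triangle-split : ∀ {a b c} k → a ≤ k → b ≤ k → k ≤ a + b → a + b + c ≤ k + k →
                 ∃[ p ] ∃[ q ] ∃[ r ] (a ≤ p + r × b ≤ r + q × c ≤ p + q × p + (r + q) ≡ k)
triangle-split {a} {c = c} k a≤k b≤k k≤a+b s≤k+k with m≤n⇒∃[o]m+o≡n a≤k
... | q , refl with m≤n⇒∃[o]m+o≡n (+-cancelˡ-≤ a q _ k≤a+b)
... | r , refl with m≤n⇒∃[o]m+o≡n b≤k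
... | p , q+r+p≡a+q with +-cancelˡ-≡ q _ _ (trans (sym (+-assoc q r p)) (trans q+r+p≡a+q (+-comm a q)))
... | refl = p , q , r , ≤-reflexive (+-comm r p) , ≤-reflexive (+-comm q r) , c≤p+q , sum≡k
  where
  c≤p+q : c ≤ p + q
  c≤p+q = +-cancelˡ-≤ (r + p + (q + r)) _ _ (subst (r + p + (q + r) + c ≤_) (rearrange p q r) s≤k+k)
    where
    rearrange : ∀ p q r → r + p + q + (r + p + q) ≡ r + p + (q + r) + (p + q)
    rearrange = solve-∀
  sum≡k : p + (r + q) ≡ r + p + q
  sum≡k = trans (sym (+-assoc p r q)) (cong (_+ q) (+-comm p r))

hamming-++ : ∀ {m k} (xs ys : Vec Bool m) (us vs : Vec Bool k) →
             hamming (xs ++ us) (ys ++ vs) ≡ hamming xs ys + hamming us vs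
hamming-++ []           []           us vs = refl
hamming-++ (true ∷ xs)  (true ∷ ys)  us vs = hamming-++ xs ys us vs
hamming-++ (false ∷ xs) (false ∷ ys) us vs = hamming-++ xs ys us vs
hamming-++ (true ∷ xs)  (false ∷ ys) us vs = cong suc (hamming-++ xs ys us vs)
hamming-++ (false ∷ xs) (true ∷ ys)  us vs = cong suc (hamming-++ xs ys us vs)

hamming-replicate : ∀ n x y → hamming (replicate n x) (replicate n y) ≡ (if x xor y then n else 0)
hamming-replicate zero    true  true  = refl
hamming-replicate zero    true  false = refl
hamming-replicate zero    false true  = refl
hamming-replicate zero    false false = refl
hamming-replicate (suc n) true  true  = hamming-replicate n true true
hamming-replicate (suc n) true  false = cong suc (hamming-replicate n true false)
hamming-replicate (suc n) false true  = cong suc (hamming-replicate n false true)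
hamming-replicate (suc n) false false = hamming-replicate n false false

hamming-bit-sum≤2 : ∀ x y z → hamming [ x ] [ y ] + hamming [ y ] [ z ] + hamming [ x ] [ z ] ≤ 2
hamming-bit-sum≤2 true  true  true  = z≤n
hamming-bit-sum≤2 true  true  false = ≤-refl
hamming-bit-sum≤2 true  false true  = ≤-refl
hamming-bit-sum≤2 true  false false = ≤-refl
hamming-bit-sum≤2 false true  true  = ≤-refl
hamming-bit-sum≤2 false true  false = ≤-refl
hamming-bit-sum≤2 false false true  = ≤-refl
hamming-bit-sum≤2 false false false = z≤n

hamming-sum≤ : ∀ {m} (xs ys zs : Vec Bool m) → hamming xs ys + hamming ys zs + hamming xs zs ≤ m + m
hamming-sum≤ [] [] [] = z≤n
hamming-sum≤ {suc m} (x ∷ xs) (y ∷ ys) (z ∷ zs) = begin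
  hamming (x ∷ xs) (y ∷ ys) + hamming (y ∷ ys) (z ∷ zs) + hamming (x ∷ xs) (z ∷ zs)
    ≡⟨ cong₂ _+_ (cong₂ _+_ (hamming-++ [ x ] [ y ] xs ys) (hamming-++ [ y ] [ z ] ys zs))
                 (hamming-++ [ x ] [ z ] xs zs) ⟩
  (hamming [ x ] [ y ] + hamming xs ys) + (hamming [ y ] [ z ] + hamming ys zs)
    + (hamming [ x ] [ z ] + hamming xs zs)
    ≡⟨ interchange (hamming [ x ] [ y ]) _ (hamming [ y ] [ z ]) _ (hamming [ x ] [ z ]) _ ⟩
  (hamming [ x ] [ y ] + hamming [ y ] [ z ] + hamming [ x ] [ z ])
    + (hamming xs ys + hamming ys zs + hamming xs zs)
    ≤⟨ +-mono-≤ (hamming-bit-sum≤2 x y z) (hamming-sum≤ xs ys zs) ⟩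
  2 + (m + m)
    ≡⟨ cong suc (sym (+-suc m m)) ⟩
  suc m + suc m ∎
  where
  open ≤-Reasoning
  interchange : ∀ d₁ h₁ d₂ h₂ d₃ h₃ →
                (d₁ + h₁) + (d₂ + h₂) + (d₃ + h₃) ≡ (d₁ + d₂ + d₃) + (h₁ + h₂ + h₃)
  interchange = solve-∀

weight-≥ : ∀ {G u v} → (∀ x → w G x x ≡ 0) → (∀ x y z → w G x z ≤ w G x y + w G y z) →
           (p : Walk G u v) → w G u v ≤ weight p
weight-≥ {u = u} diag _ [] = ≤-reflexive (diag u)
weight-≥ {G} {u} {v} diag triangle (step {x = x} _ p) =
  ≤-trans (triangle u x v) (+-monoʳ-≤ (w G u x) (weight-≥ diag triangle p))

IsAddressing⇒w≤hamming : ∀ {G m f} → (∀ x → w G x x ≡ 0) → (∀ x y z → w G x z ≤ w G x y + w G y z) →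
                         IsAddressing G m f → ∀ u v → w G u v ≤ hamming (f u) (f v)
IsAddressing⇒w≤hamming diag triangle isAddressing u v =
  let p , weight≤ = isAddressing u v in ≤-trans (weight-≥ diag triangle p) weight≤

complete⇒IsAddressing : ∀ {G m} (f : Fin (n G) → Vec Bool m) → (∀ {u v} → ¬ u ≡ v → Adj G u v) →
                        (∀ u v → ¬ u ≡ v → w G u v ≤ hamming (f u) (f v)) → IsAddressing G m f
complete⇒IsAddressing {G} f complete w≤hamming u v with u Fin.≟ v
... | yes refl = [] , z≤n
... | no u≢v   = step (complete u≢v) [] , ≤-trans (≤-reflexive (+-identityʳ (w G u v))) (w≤hamming u v u≢v)

triW-diagonal : ∀ a b c x → triW a b c x x ≡ 0
triW-diagonal a b c 0F = refl
triW-diagonal a b c 1F = refl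
triW-diagonal a b c 2F = refl

triW-triangle : ∀ {a b c} → a ≤ b + c → b ≤ a + c → c ≤ a + b →
                ∀ x y z → triW a b c x z ≤ triW a b c x y + triW a b c y z
triW-triangle {a} {b} {c} a≤b+c b≤a+c c≤a+b = triangle
  where
  triangle : ∀ x y z → triW a b c x z ≤ triW a b c x y + triW a b c y z
  triangle 0F 1F 2F = c≤a+b
  triangle 0F 2F 1F = subst (a ≤_) (+-comm b c) a≤b+c
  triangle 1F 0F 2F = b≤a+c
  triangle 1F 2F 0F = a≤b+c
  triangle 2F 0F 1F = subst (b ≤_) (+-comm a c) b≤a+c
  triangle 2F 1F 0F = subst (c ≤_) (+-comm a b) c≤a+b
  triangle 0F 0F 0F = z≤n
  triangle 0F 0F 1F = ≤-refl
  triangle 0F 0F 2F = ≤-refl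
  triangle 0F 1F 0F = z≤n
  triangle 0F 1F 1F = m≤m+n a 0
  triangle 0F 2F 0F = z≤n
  triangle 0F 2F 2F = m≤m+n c 0
  triangle 1F 0F 0F = m≤m+n a 0
  triangle 1F 0F 1F = z≤n
  triangle 1F 1F 0F = ≤-refl
  triangle 1F 1F 1F = z≤n
  triangle 1F 1F 2F = ≤-refl
  triangle 1F 2F 1F = z≤n
  triangle 1F 2F 2F = m≤m+n b 0
  triangle 2F 0F 0F = m≤m+n c 0
  triangle 2F 0F 2F = z≤n
  triangle 2F 1F 1F = m≤m+n b 0
  triangle 2F 1F 2F = z≤n
  triangle 2F 2F 0F = ≤-refl
  triangle 2F 2F 1F = ≤-refl
  triangle 2F 2F 2F = z≤n

C₃-addressing-length : ∀ {a b c m} → a ≤ b + c → b ≤ a + c → c ≤ a + b →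
                       HasAddressing (C₃ a b c) m → a + b + c ≤ m + m
C₃-addressing-length {a} {b} {c} a≤b+c b≤a+c c≤a+b (f , isAddressing) =
  ≤-trans (+-mono-≤ (+-mono-≤ (w≤hamming 0F 1F) (w≤hamming 1F 2F)) (w≤hamming 0F 2F))
          (hamming-sum≤ (f 0F) (f 1F) (f 2F))
  where
  w≤hamming : ∀ u v → triW a b c u v ≤ hamming (f u) (f v)
  w≤hamming = IsAddressing⇒w≤hamming {f = f} (triW-diagonal a b c) (triW-triangle a≤b+c b≤a+c c≤a+b) isAddressing

blocks : ∀ p r q → Bool → Bool → Bool → Vec Bool (p + (r + q))
blocks p r q x y z = replicate p x ++ replicate r y ++ replicate q z

hamming-blocks : ∀ p r q x y z x′ y′ z′ →
  hamming (blocks p r q x y z) (blocks p r q x′ y′ z′) ≡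
  (if x xor x′ then p else 0) + ((if y xor y′ then r else 0) + (if z xor z′ then q else 0))
hamming-blocks p r q x y z x′ y′ z′ =
  trans (hamming-++ (replicate p x) (replicate p x′) _ _)
        (cong₂ _+_ (hamming-replicate p x x′)
                   (trans (hamming-++ (replicate r y) (replicate r y′) _ _)
                          (cong₂ _+_ (hamming-replicate r y y′) (hamming-replicate q z z′))))

C₃-blockAddress : ∀ p r q → Fin 3 → Vec Bool (p + (r + q))
C₃-blockAddress p r q 0F = blocks p r q true  false false
C₃-blockAddress p r q 1F = blocks p r q false true  false
C₃-blockAddress p r q 2F = blocks p r q false false true

C₃-blockAddress-isAddressing : ∀ {a b c} p r q → a ≤ p + r → b ≤ r + q → c ≤ p + q →
                               IsAddressing (C₃ a b c) (p + (r + q)) (C₃-blockAddress p r q)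
C₃-blockAddress-isAddressing {a} {b} {c} p r q a≤p+r b≤r+q c≤p+q =
  complete⇒IsAddressing (C₃-blockAddress p r q) (λ u≢v → u≢v) w≤hamming
  where
  a≤ : a ≤ p + (r + 0)
  a≤ = subst (λ s → a ≤ p + s) (sym (+-identityʳ r)) a≤p+r
  w≤hamming : ∀ u v → ¬ u ≡ v → triW a b c u v ≤ hamming (C₃-blockAddress p r q u) (C₃-blockAddress p r q v)
  w≤hamming 0F 0F _ = z≤n
  w≤hamming 1F 1F _ = z≤n
  w≤hamming 2F 2F _ = z≤n
  w≤hamming 0F 1F _ = subst (a ≤_) (sym (hamming-blocks p r q true false false false true false)) a≤
  w≤hamming 1F 0F _ = subst (a ≤_) (sym (hamming-blocks p r q false true false true false false)) a≤
  w≤hamming 1F 2F _ = subst (b ≤_) (sym (hamming-blocks p r q false true false false false true)) b≤r+q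
  w≤hamming 2F 1F _ = subst (b ≤_) (sym (hamming-blocks p r q false false true false true false)) b≤r+q
  w≤hamming 0F 2F _ = subst (c ≤_) (sym (hamming-blocks p r q true false false false false true)) c≤p+q
  w≤hamming 2F 0F _ = subst (c ≤_) (sym (hamming-blocks p r q false false true true false false)) c≤p+q

C₃-hasAddressing : ∀ {a b c} → a ≤ b + c → b ≤ a + c → c ≤ a + b → HasAddressing (C₃ a b c) ⌈ a + b + c /2⌉
C₃-hasAddressing {a} {b} {c} a≤b+c b≤a+c c≤a+b =
  let p , q , r , a≤p+r , b≤r+q , c≤p+q , length≡k = triangle-split ⌈ a + b + c /2⌉ a≤k b≤k k≤a+b
                                                                      (n≤⌈n/2⌉+⌈n/2⌉ (a + b + c))
  in subst (HasAddressing (C₃ a b c)) length≡k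
       (C₃-blockAddress p r q , C₃-blockAddress-isAddressing p r q a≤p+r b≤r+q c≤p+q)
  where
  a≤k : a ≤ ⌈ a + b + c /2⌉
  a≤k = m+m≤n⇒m≤⌈n/2⌉ (subst (a + a ≤_) (sym (+-assoc a b c)) (+-monoʳ-≤ a a≤b+c))
  b≤k : b ≤ ⌈ a + b + c /2⌉
  b≤k = m+m≤n⇒m≤⌈n/2⌉ (subst (b + b ≤_) (rearrange a b c) (+-monoʳ-≤ b b≤a+c))
    where
    rearrange : ∀ a b c → b + (a + c) ≡ a + b + c
    rearrange = solve-∀
  k≤a+b : ⌈ a + b + c /2⌉ ≤ a + b
  k≤a+b = n≤m+m⇒⌈n/2⌉≤m (+-monoʳ-≤ (a + b) c≤a+b)

lemma4 : (a b c : ℕ) → 1 ≤ a → 1 ≤ b → 1 ≤ c →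
    a ≤ b + c → b ≤ a + c → c ≤ a + b →
    AddressingNumberIs (C₃ a b c) ⌈ a + b + c /2⌉
lemma4 a b c _ _ _ a≤b+c b≤a+c c≤a+b =
  C₃-hasAddressing a≤b+c b≤a+c c≤a+b ,
  λ m m<k hasAddressing → <⇒≱ m<k (n≤m+m⇒⌈n/2⌉≤m (C₃-addressing-length a≤b+c b≤a+c c≤a+b hasAddressing))
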